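{- Let $\Sigma$ be a finite CW complex of dimension $d$, let $C$ be a circuit of the cellular matroid of $\Sigma$, and let $\Delta=\Sigma_{(d-1)}\cup C$. Then there are signs $\epsilon_\sigma\in\{\pm1\}$ ($\sigma\in C$) such that the vector $$\sum_{\sigma\in C}\epsilon_\sigma\,\mathbf{t}_{d-1}(\Delta\setminus\sigma)\,\sigma$$ spans the (one-dimensional) space of vectors in the flow space $\ker_{\mathbb{R}}\partial_d$ supported on $C$; in particular it is a nonzero flow vector with support exactly $C$.
   Context: $\Sigma$ has the convention of a unique $(-1)$-cell (reduced homology); $\Sigma_{(d-1)}$ is the $(d-1)$-skeleton; $d$-cells are facets, oriented, identified with the standard basis of $C_d(\Sigma;\mathbb{R})$; $\partial_d$ is the top cellular boundary map. The cellular matroid is the matroid on the facets represented over $\mathbb{R}$ by the columns of $\partial_d$; a circuit is a minimal linearly dependent set of columns. $\Delta\setminus\sigma$ denotes the subcomplex $\Sigma_{(d-1)}\cup(C\setminus\{\sigma\})$, and $\mathbf{t}_{d-1}(X)=|\operatorname{tor}(\tilde H_{d-1}(X;\mathbb{Z}))|$.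
   Formalization: The flow space and the linear dependence of columns of $\partial_d$ defining the cellular matroid are taken over ℚ instead of ℝ. -}

module Defs where

open import Data.Nat using (ℕ; zero; suc; _<_)
open import Data.Fin using (Fin; zero; suc)
open import Data.Fin.Subset using (Subset; _∈_; _∉_; _⊂_)
open import Data.Integer as ℤ using (ℤ; _◃_)
open import Data.Sign using (Sign)
open import Data.Rational as ℚ using (ℚ; 0ℚ)
open import Data.Product using (Σ; ∃; _×_)
open import Data.Unit using (⊤)
open import Data.Sum using (_⊎_)
open import Data.Bool using (if_then_else_)
open import Data.Vec using (lookup)
open import Relation.Binary.PropositionalEquality using (_≡_; _≢_)
open import Relation.Nullary using (¬_)

sumℤ : (n : ℕ) → (Fin n → ℤ) → ℤ
sumℤ zero    f = ℤ.0ℤ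
sumℤ (suc n) f = f zero ℤ.+ sumℤ n (λ i → f (suc i))

sumℚ : (n : ℕ) → (Fin n → ℚ) → ℚ
sumℚ zero    f = 0ℚ
sumℚ (suc n) f = f zero ℚ.+ sumℚ n (λ i → f (suc i))

toℚ : ℤ → ℚ
toℚ z = z ℚ./ 1

-- A finite CW complex of dimension d, through its (reduced, augmented)
-- cellular chain complex with respect to the oriented cells.
-- Levels are shifted by one: level k holds the (k-1)-dimensional cells.
-- Level 0 holds the unique (-1)-cell, level (d+1) holds the d-cells
-- (facets).  bd k j i is the coefficient of the level-k cell i in the
-- cellular boundary of the level-(k+1) cell j, i.e.  bd k  is the
-- cellular boundary map  ∂_k : C_k → C_(k-1)  (dimension indexing).

record CWComplex (d : ℕ) : Set where
  field
    cells     : ℕ → ℕ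
    bd        : (k : ℕ) → Fin (cells (suc k)) → Fin (cells k) → ℤ
    minusCell : cells 0 ≡ 1
    augment   : (v : Fin (cells 1)) (i : Fin (cells 0)) → bd 0 v i ≡ ℤ.1ℤ
    bdbd      : (k : ℕ) (j : Fin (cells (suc (suc k)))) (i : Fin (cells k)) →
                sumℤ (cells (suc k)) (λ l → bd (suc k) j l ℤ.* bd k l i) ≡ ℤ.0ℤ
    hasFacet  : 0 < cells (suc d)
    noHigher  : (k : ℕ) → suc d < k → cells k ≡ 0

module _ {d : ℕ} (Σc : CWComplex d) where
  open CWComplex Σc

  nFacets : ℕ
  nFacets = cells (suc d)

  nRidges : ℕ
  nRidges = cells d

  ∂d : Fin nFacets → Fin nRidges → ℤ
  ∂d = bd d

  -- a real(=rational) vector on the facets lies in the flow space ker ∂_d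
  IsFlowℚ : (Fin nFacets → ℚ) → Set
  IsFlowℚ w = (i : Fin nRidges) →
    sumℚ nFacets (λ j → w j ℚ.* toℚ (∂d j i)) ≡ 0ℚ

  SupportedOn : (Fin nFacets → ℚ) → Subset nFacets → Set
  SupportedOn w S = (j : Fin nFacets) → j ∉ S → w j ≡ 0ℚ

  Dependent : Subset nFacets → Set
  Dependent S = Σ (Fin nFacets → ℚ) λ w →
    IsFlowℚ w × SupportedOn w S × ∃ λ j → w j ≢ 0ℚ

  IsCircuit : Subset nFacets → Set
  IsCircuit C = Dependent C × ((D : Subset nFacets) → D ⊂ C → ¬ Dependent D)

  -- Homology of Δ ∖ σ in dimension d-1 (level d), where
  -- Δ ∖ σ = Σ_(d-1) ∪ (C ∖ {σ}).

  -- integral (d-1)-cycles of Σ (equivalently of any subcomplex containing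
  -- the (d-1)-skeleton); for d = 0 the (-1)-chains are all cycles.
  IsCycle : (k : ℕ) → (Fin (cells k) → ℤ) → Set
  IsCycle zero    z = ⊤
  IsCycle (suc k) z = (i : Fin (cells k)) →
    sumℤ (cells (suc k)) (λ l → z l ℤ.* bd k l i) ≡ ℤ.0ℤ

  IsBoundaryIn : Subset nFacets → Fin nFacets → (Fin nRidges → ℤ) → Set
  IsBoundaryIn C σ z = Σ (Fin nFacets → ℤ) λ a →
    ((j : Fin nFacets) → (j ∉ C ⊎ j ≡ σ) → a j ≡ ℤ.0ℤ) ×
    ((i : Fin nRidges) → z i ≡ sumℤ nFacets (λ j → a j ℤ.* ∂d j i))

  IsTorsionCycle : Subset nFacets → Fin nFacets → (Fin nRidges → ℤ) → Set
  IsTorsionCycle C σ z = IsCycle d z ×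
    Σ ℕ λ m → (0 < m) × IsBoundaryIn C σ (λ i → ℤ.+ m ℤ.* z i)

  Homologous : Subset nFacets → Fin nFacets → (Fin nRidges → ℤ) → (Fin nRidges → ℤ) → Set
  Homologous C σ z z' = IsBoundaryIn C σ (λ i → z i ℤ.- z' i)

  -- t = t_(d-1)(Δ ∖ σ) = |tor H̃_(d-1)(Δ ∖ σ; ℤ)|: the torsion subgroup
  -- (a quotient of torsion cycles by homology) is in bijection with Fin t.
  TorsionOrder : Subset nFacets → Fin nFacets → ℕ → Set
  TorsionOrder C σ t = Σ (Fin t → (Fin nRidges → ℤ)) λ f →
    ((a : Fin t) → IsTorsionCycle C σ (f a)) ×
    ((a b : Fin t) → Homologous C σ (f a) (f b) → a ≡ b) ×
    ((z : Fin nRidges → ℤ) → IsTorsionCycle C σ z → ∃ λ a → Homologous C σ z (f a))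

  signedVector : Subset nFacets → (Fin nFacets → Sign) → (Fin nFacets → ℕ) → Fin nFacets → ℤ
  signedVector C ε t j = if lookup C j then ε j ◃ t j else ℤ.0ℤ

module Submission where

-- Fix a facet σ of the circuit C.  The boundaries of Δ are those of Δ ∖ σ together with the
-- multiples of ∂σ, so the torsion of H̃_(d-1)(Δ ∖ σ) maps onto the torsion of H̃_(d-1)(Δ), whose
-- order N does not depend on σ, with cyclic kernel generated by [∂σ]; the order o_σ of that kernel
-- is the least k > 0 for which k ∂σ bounds in Δ ∖ σ.  Hence t_σ = N o_σ.
-- On the other hand k ∂σ bounds in Δ ∖ σ exactly when some integral flow supported on C has
-- σ-coefficient k, and since C is a circuit all these flows are proportional.  For the flow x with
-- x_ρ = o_ρ this forces |x_σ| = o_σ for every σ ∈ C, so with ε = sign ∘ x the signed vector is N x: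
-- a nonzero multiple of a flow, which spans the flows supported on C.

open import Defs
open import Data.Nat as ℕ using (ℕ; zero; suc; _<_; _≤_; z≤n; s≤s)
import Data.Nat.Properties as ℕP
open import Data.Fin as Fin using (Fin; zero; suc; toℕ; fromℕ; fromℕ<; inject; combine; remQuot)
import Data.Fin.Properties as FinP
open import Data.Fin.Subset using (Subset; _∈_; _∉_) renaming (_-_ to _∖_)
open import Data.Fin.Subset.Properties using (_∈?_; x∈p⇒p-x⊂p; x∈p∧x≢y⇒x∈p-y)
open import Data.Integer using (ℤ; +_; 0ℤ; 1ℤ; -1ℤ; _+_; -_; _-_; ∣_∣; sign; _◃_)
import Data.Integer.Properties as ℤP
open import Data.Integer.DivMod using (_/ℕ_; _%ℕ_; n%ℕd<d; a≡a%ℕn+[a/ℕn]*n)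
open import Data.Integer.Tactic.RingSolver using (solve-∀)
open import Data.Rational as ℚ using (ℚ; 0ℚ; ↥_; ↧ₙ_)
import Data.Rational.Properties as ℚP
open import Data.Rational.Solver using (module +-*-Solver)
import Data.Rational.Unnormalised as ℚᵘ
import Data.Rational.Unnormalised.Properties as ℚᵘP
open import Data.Sign using (Sign)
open import Data.Bool using (true; false)
import Data.Vec as Vec
import Data.Vec.Properties as VecP
open import Data.List as List using (List; filter; allFin; length)
open import Data.List.Membership.Propositional.Properties using (∈-filter⁺; ∈-filter⁻; ∈-allFin; ∈-lookup)
import Data.List.Relation.Unary.Any as Any
import Data.List.Relation.Unary.Any.Properties as AnyP
import Data.List.Relation.Unary.All as All
open import Data.List.Relation.Unary.AllPairs using (_∷_)
open import Data.List.Relation.Unary.Unique.Propositional using (Unique)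
import Data.List.Relation.Unary.Unique.Propositional.Properties as UniqueP
open import Data.Product using (Σ; ∃; _×_; _,_; proj₁; proj₂; uncurry)
open import Data.Sum using (_⊎_; inj₁; inj₂)
open import Data.Unit using (tt)
open import Data.Empty using (⊥-elim)
open import Function using (_∘_)
open import Relation.Binary.Definitions using (tri<; tri≈; tri>)
open import Relation.Binary.Structures using (IsEquivalence)
open import Relation.Binary.PropositionalEquality
open import Relation.Nullary using (¬_; Dec; yes; no)
open import Relation.Nullary.Decidable using (¬?; _→-dec_; map′; decidable-stable)
open import Relation.Unary using (Decidable)

toℕ-inject-fromℕ< : ∀ {n} {i : Fin n} {j : ℕ} (j<i : j ℕ.< toℕ i) → toℕ (inject (fromℕ< j<i)) ≡ j
toℕ-inject-fromℕ< j<i = trans (FinP.toℕ-inject (fromℕ< j<i)) (FinP.toℕ-fromℕ< j<i)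

least-in-Fin : ∀ {n} {P : Fin n → Set} → Decidable P → ∀ {a} → P a →
  ∃ λ b → P b × (∀ {c} → c Fin.< b → ¬ P c)
least-in-Fin {n} {P} P? {a} pa with FinP.¬∀⟶∃¬-smallest n (¬_ ∘ P) (¬? ∘ P?) (λ ∀¬P → ∀¬P a pa)
... | b , ¬¬Pb , below = b , decidable-stable (P? b) ¬¬Pb ,
  λ c<b Pc → below (fromℕ< c<b) (subst P (sym (FinP.toℕ-injective (toℕ-inject-fromℕ< c<b))) Pc)

least-witness : ∀ {P : ℕ → Set} → Decidable P → ∀ {n} → P n →
  ∃ λ k → P k × (∀ {j} → P j → k ℕ.≤ j)
least-witness {P} P? {n} Pn with least-in-Fin (P? ∘ toℕ) {fromℕ n} (subst P (sym (FinP.toℕ-fromℕ n)) Pn)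
... | b , Pb , below = toℕ b , Pb , λ Pj → ℕP.≮⇒≥ λ j<b →
  below (subst (ℕ._< toℕ b) (sym (FinP.toℕ-fromℕ< _)) j<b)
        (subst P (sym (FinP.toℕ-fromℕ< (ℕP.<-≤-trans j<b (FinP.toℕ≤n b)))) Pj)

*-≤-≡⇒≡ : ∀ {a b A B} → a ℕ.≤ A → b ℕ.≤ B → A ℕ.* B ≡ a ℕ.* b → 0 ℕ.< b → A ≡ a
*-≤-≡⇒≡ {a} {b} {A} {B} a≤A b≤B AB≡ab b>0 = ℕP.*-cancelʳ-≡ A a b {{ℕ.>-nonZero b>0}} (ℕP.≤-antisym
  (ℕP.≤-trans (ℕP.*-monoʳ-≤ A b≤B) (ℕP.≤-reflexive AB≡ab))
  (ℕP.*-monoˡ-≤ b a≤A))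

lookup-injective : ∀ {A : Set} {xs : List A} → Unique xs → ∀ {i j} → List.lookup xs i ≡ List.lookup xs j → i ≡ j
lookup-injective                    (_ ∷ _)  {zero}  {zero}  _  = refl
lookup-injective {xs = _ List.∷ xs} (x∉ ∷ _) {zero}  {suc j} eq = ⊥-elim (All.lookup x∉ (∈-lookup {xs = xs} j) eq)
lookup-injective {xs = _ List.∷ xs} (x∉ ∷ _) {suc i} {zero}  eq = ⊥-elim (All.lookup x∉ (∈-lookup {xs = xs} i) (sym eq))
lookup-injective                    (_ ∷ u)  {suc i} {suc j} eq = cong suc (lookup-injective u eq)

-- Fin n lists the ≈-classes of S, as TorsionOrder does for the torsion classes of Δ ∖ σ.
record Enumeration {A : Set} (S : A → Set) (_≈_ : A → A → Set) (n : ℕ) : Set where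
  field
    rep            : Fin n → A
    rep∈S          : ∀ a → S (rep a)
    rep-injective  : ∀ {a b} → rep a ≈ rep b → a ≡ b
    rep-surjective : ∀ {z} → S z → ∃ λ a → z ≈ rep a

  index : ∀ {z} → S z → Fin n
  index = proj₁ ∘ rep-surjective

  ≈-rep-index : ∀ {z} (s : S z) → z ≈ rep (index s)
  ≈-rep-index = proj₂ ∘ rep-surjective

Enumeration-cong : ∀ {A} {S S′ : A → Set} {_≈_} {n} → (∀ {z} → S z → S′ z) → (∀ {z} → S′ z → S z) →
  Enumeration S _≈_ n → Enumeration S′ _≈_ n
Enumeration-cong S⇒S′ S′⇒S E = record
  { rep = rep ; rep∈S = S⇒S′ ∘ rep∈S ; rep-injective = rep-injective ; rep-surjective = rep-surjective ∘ S′⇒S }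
  where open Enumeration E

module Quotients {A : Set} {S : A → Set} {_≈_ _∼_ : A → A → Set}
  (≈-equiv : IsEquivalence _≈_) (∼-equiv : IsEquivalence _∼_) (≈⇒∼ : ∀ {z z′} → z ≈ z′ → z ∼ z′) where

  open IsEquivalence ≈-equiv using () renaming (sym to ≈-sym; trans to ≈-trans)
  open IsEquivalence ∼-equiv using () renaming (refl to ∼-refl; reflexive to ∼-reflexive; sym to ∼-sym; trans to ∼-trans)

  module _ {n} (E : Enumeration S _≈_ n) where
    open Enumeration E

    index-sound : ∀ {z z′} (s : S z) (s′ : S z′) → index s ≡ index s′ → z ≈ z′
    index-sound s s′ eq = ≈-trans (≈-rep-index s) (subst (λ a → rep a ≈ _) (sym eq) (≈-sym (≈-rep-index s′)))

    index-complete : ∀ {z z′} (s : S z) (s′ : S z′) → z ≈ z′ → index s ≡ index s′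
    index-complete s s′ z≈z′ = rep-injective (≈-trans (≈-sym (≈-rep-index s)) (≈-trans z≈z′ (≈-rep-index s′)))

    ≈-decidable : ∀ {z z′} → S z → S z′ → Dec (z ≈ z′)
    ≈-decidable s s′ = map′ (index-sound s s′) (index-complete s s′) (index s FinP.≟ index s′)

  coarsen : ∀ {t} → Enumeration S _≈_ t → (∀ {z z′} → S z → S z′ → Dec (z ∼ z′)) →
    ∃ λ N → Enumeration S _∼_ N
  coarsen {t} E _∼?_ = length firsts , record
    { rep            = rep ∘ List.lookup firsts
    ; rep∈S          = rep∈S ∘ List.lookup firsts
    ; rep-injective  = classes-injective
    ; rep-surjective = classes-surjective
    }
    where
    open Enumeration E
    FirstOfClass : Fin t → Set
    FirstOfClass a = ∀ {b} → b Fin.< a → ¬ rep b ∼ rep a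

    firstOfClass? : Decidable FirstOfClass
    firstOfClass? a = map′ (λ f {b} → f b) (λ f b → f) (FinP.all? λ b → b FinP.<? a →-dec ¬? (rep∈S b ∼? rep∈S a))

    firsts : List (Fin t)
    firsts = filter firstOfClass? (allFin t)

    isFirst : ∀ h → FirstOfClass (List.lookup firsts h)
    isFirst h = proj₂ (∈-filter⁻ firstOfClass? {xs = allFin t} (∈-lookup {xs = firsts} h))

    classes-injective : ∀ {h h′} → rep (List.lookup firsts h) ∼ rep (List.lookup firsts h′) → h ≡ h′
    classes-injective {h} {h′} r with FinP.<-cmp (List.lookup firsts h) (List.lookup firsts h′)
    ... | tri< lt _ _ = ⊥-elim (isFirst h′ lt r)
    ... | tri> _ _ gt = ⊥-elim (isFirst h gt (∼-sym r))
    ... | tri≈ _ eq _ = lookup-injective (UniqueP.filter⁺ firstOfClass? (UniqueP.allFin⁺ t)) eq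

    classes-surjective : ∀ {z} → S z → ∃ λ h → z ∼ rep (List.lookup firsts h)
    classes-surjective s with least-in-Fin (λ b → rep∈S b ∼? rep∈S (index s)) (∼-refl {rep (index s)})
    ... | b , b∼ , below = Any.index b∈firsts ,
      ∼-trans (≈⇒∼ (≈-rep-index s)) (∼-trans (∼-sym b∼) (∼-reflexive (cong rep (AnyP.lookup-index b∈firsts))))
      where
      b∈firsts = ∈-filter⁺ firstOfClass? (∈-allFin b) (λ c<b c∼b → below c<b (∼-trans c∼b b∼))

  -- every ∼-class of S consists of the o distinct ≈-classes of shift z k, k < o
  record CyclicFibres (o : ℕ) : Set where
    field
      shift           : A → Fin o → A
      shift-∈         : ∀ {z} k → S z → S (shift z k)
      shift-∼         : ∀ z k → shift z k ∼ z
      ∼-shift         : ∀ {z z′} → z ∼ z′ → ∃ λ k → z ≈ shift z′ k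
      shift-injective : ∀ z {k k′} → shift z k ≈ shift z k′ → k ≡ k′

  module _ {t o} (E : Enumeration S _≈_ t) (F : CyclicFibres o) where
    open Enumeration E
    open CyclicFibres F

    ∼-decidable : ∀ {z z′} → S z → S z′ → Dec (z ∼ z′)
    ∼-decidable {z} {z′} s s′ = map′
      (λ (k , z≈) → ∼-trans (≈⇒∼ z≈) (shift-∼ z′ k)) ∼-shift
      (FinP.any? λ k → ≈-decidable E s (shift-∈ k s′))

    count : ∀ {N} → Enumeration S _∼_ N → t ≡ N ℕ.* o
    count {N} C = ℕP.≤-antisym
      (FinP.injective⇒≤ {f = uncurry combine ∘ coordinates} coordinates-injective)
      (FinP.injective⇒≤ {f = point ∘ remQuot o} point-injective)
      where
      module C = Enumeration C

      coordinates : Fin t → Fin N × Fin o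
      coordinates a = C.index (rep∈S a) , proj₁ (∼-shift (C.≈-rep-index (rep∈S a)))

      ≈-coordinates : ∀ a → rep a ≈ shift (C.rep (proj₁ (coordinates a))) (proj₂ (coordinates a))
      ≈-coordinates a = proj₂ (∼-shift (C.≈-rep-index (rep∈S a)))

      coordinates-injective : ∀ {a b} → uncurry combine (coordinates a) ≡ uncurry combine (coordinates b) → a ≡ b
      coordinates-injective {a} {b} eq with FinP.combine-injective _ _ _ _ eq
      ... | h≡ , k≡ = rep-injective (≈-trans (≈-coordinates a)
        (subst₂ (λ h k → shift (C.rep h) k ≈ rep b) (sym h≡) (sym k≡) (≈-sym (≈-coordinates b))))

      point : Fin N × Fin o → Fin t
      point (h , k) = index (shift-∈ k (C.rep∈S h))

      pairs-equal : ∀ {h h′ k k′} → shift (C.rep h) k ≈ shift (C.rep h′) k′ → (h , k) ≡ (h′ , k′)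
      pairs-equal {h} {h′} {k} {k′} shifts≈ with C.rep-injective {h} {h′}
        (∼-trans (∼-sym (shift-∼ (C.rep h) k)) (∼-trans (≈⇒∼ shifts≈) (shift-∼ (C.rep h′) k′)))
      ... | refl = cong (h ,_) (shift-injective (C.rep h) shifts≈)

      point-injective : ∀ {i j} → point (remQuot o i) ≡ point (remQuot o j) → i ≡ j
      point-injective {i} {j} eq = trans (sym (FinP.combine-remQuot {N} o i))
        (trans (cong (uncurry combine) (pairs-equal (index-sound E _ _ eq))) (FinP.combine-remQuot {N} o j))

module IntegerLinearAlgebra where
  open import Data.Integer using (_*_)

  sumℤ-cong : ∀ n {f g : Fin n → ℤ} → f ≗ g → sumℤ n f ≡ sumℤ n g
  sumℤ-cong zero    f≗g = refl
  sumℤ-cong (suc n) f≗g = cong₂ _+_ (f≗g zero) (sumℤ-cong n (f≗g ∘ suc))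

  sumℤ-zero : ∀ n {f : Fin n → ℤ} → (∀ j → f j ≡ 0ℤ) → sumℤ n f ≡ 0ℤ
  sumℤ-zero zero    f≗0 = refl
  sumℤ-zero (suc n) f≗0 = cong₂ _+_ (f≗0 zero) (sumℤ-zero n (f≗0 ∘ suc))

  sumℤ-lincomb : ∀ n (p q : ℤ) (f g : Fin n → ℤ) →
    sumℤ n (λ j → p * f j + q * g j) ≡ p * sumℤ n f + q * sumℤ n g
  sumℤ-lincomb zero    p q f g = sym (cong₂ _+_ (ℤP.*-zeroʳ p) (ℤP.*-zeroʳ q))
  sumℤ-lincomb (suc n) p q f g = trans
    (cong (_+_ (p * f zero + q * g zero)) (sumℤ-lincomb n p q (f ∘ suc) (g ∘ suc)))
    (rearrange p q (f zero) (g zero) (sumℤ n (f ∘ suc)) (sumℤ n (g ∘ suc)))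
    where
    rearrange : ∀ p q a b x y → p * a + q * b + (p * x + q * y) ≡ p * (a + x) + q * (b + y)
    rearrange = solve-∀

  record IsSubmodule {n} (B : (Fin n → ℤ) → Set) : Set where
    field
      ≗-closed       : ∀ {u v} → u ≗ v → B u → B v
      0-closed       : B (λ _ → 0ℤ)
      lincomb-closed : ∀ {u v} p q → B u → B v → B (λ i → p * u i + q * v i)

    scale-closed : ∀ {u} k → B u → B (λ i → k * u i)
    scale-closed {u} k Bu = ≗-closed (λ i → identity k (u i)) (lincomb-closed k 0ℤ Bu 0-closed)
      where
      identity : ∀ k a → k * a + 0ℤ * 0ℤ ≡ k * a
      identity = solve-∀

    +-closed : ∀ {u v} → B u → B v → B (λ i → u i + v i)
    +-closed {u} {v} Bu Bv = ≗-closed (λ i → identity (u i) (v i)) (lincomb-closed 1ℤ 1ℤ Bu Bv)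
      where
      identity : ∀ a b → 1ℤ * a + 1ℤ * b ≡ a + b
      identity = solve-∀

    abs-closed : ∀ {g : Fin n → ℤ} c → B (λ i → c * g i) → B (λ i → + ∣ c ∣ * g i)
    abs-closed {g} c Bcg with ℤP.+∣i∣≡i⊎+∣i∣≡-i c
    ... | inj₁ ∣c∣≡c  = ≗-closed (λ i → cong (_* g i) (sym ∣c∣≡c)) Bcg
    ... | inj₂ ∣c∣≡-c = ≗-closed (λ i → trans (identity c (g i)) (cong (_* g i) (sym ∣c∣≡-c))) (scale-closed -1ℤ Bcg)
      where
      identity : ∀ c a → -1ℤ * (c * a) ≡ - c * a
      identity = solve-∀

    _≋_ : (Fin n → ℤ) → (Fin n → ℤ) → Set
    u ≋ v = B (λ i → u i - v i)

    ≋-isEquivalence : IsEquivalence _≋_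
    ≋-isEquivalence = record
      { refl  = λ {u} → ≗-closed (λ i → sym (ℤP.+-inverseʳ (u i))) 0-closed
      ; sym   = λ {u} {v} u≋v → ≗-closed (λ i → negate (u i) (v i)) (scale-closed -1ℤ u≋v)
      ; trans = λ {u} {v} {w} u≋v v≋w → ≗-closed (λ i → chain (u i) (v i) (w i)) (+-closed u≋v v≋w)
      }
      where
      negate : ∀ a b → -1ℤ * (a - b) ≡ b - a
      negate = solve-∀
      chain : ∀ a b c → a - b + (b - c) ≡ a - c
      chain = solve-∀

    Torsion : (Fin n → ℤ) → Set
    Torsion u = Σ ℕ λ m → 0 < m × B (λ i → + m * u i)

  -- the submodule B is B′ + ℤ g
  module Extension {n} {B B′ : (Fin n → ℤ) → Set} (B-sub : IsSubmodule B) (B′-sub : IsSubmodule B′)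
    (B′⊆B : ∀ {u} → B′ u → B u) (g : Fin n → ℤ) (g∈B : B g)
    (split : ∀ {u} → B u → ∃ λ c → B′ (λ i → u i - c * g i)) where

    open IsSubmodule B-sub using (_≋_; ≋-isEquivalence)
    open IsSubmodule B′-sub using (≗-closed; lincomb-closed; scale-closed)
      renaming (_≋_ to _≋′_; ≋-isEquivalence to ≋′-isEquivalence)

    multiple-∈B′ : ∀ {m u} → B′ (λ i → + m * g i) → B u → B′ (λ i → + m * u i)
    multiple-∈B′ {m} {u} B′mg Bu with split Bu
    ... | c , B′u-cg = ≗-closed (λ i → identity (+ m) (u i) c (g i)) (lincomb-closed (+ m) c B′u-cg B′mg)
      where
      identity : ∀ m a c x → m * (a - c * x) + c * (m * x) ≡ m * a
      identity = solve-∀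

    reduce-modulo : ∀ {o u} .{{_ : ℕ.NonZero o}} → B′ (λ i → + o * g i) → B u →
      ∃ λ (k : Fin o) → B′ (λ i → u i - + toℕ k * g i)
    reduce-modulo {o} {u} B′og Bu with split Bu
    ... | c , B′u-cg = fromℕ< (n%ℕd<d c o) ,
      ≗-closed (λ i → trans (identity (u i) c (g i) (+ (c %ℕ o)) (c /ℕ o) (+ o) (a≡a%ℕn+[a/ℕn]*n c o))
                            (cong (λ r → u i - + r * g i) (sym (FinP.toℕ-fromℕ< (n%ℕd<d c o)))))
        (lincomb-closed 1ℤ (c /ℕ o) B′u-cg B′og)
      where
      identity : ∀ a c x r q o → c ≡ r + q * o → 1ℤ * (a - c * x) + q * (o * x) ≡ a - r * x
      identity a c x r q o refl = expand a x r q o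
        where
        expand : ∀ a x r q o → 1ℤ * (a - (r + q * o) * x) + q * (o * x) ≡ a - r * x
        expand = solve-∀

    record IsOrder (o : ℕ) : Set where
      field
        positive    : 0 < o
        annihilates : B′ (λ i → + o * g i)
        minimal     : ∀ {k} → 0 < k → B′ (λ i → + k * g i) → o ≤ k

    order-exists : (∀ k → Dec (B′ (λ i → + k * g i))) → ∀ {m} → 0 < m → B′ (λ i → + m * g i) → ∃ IsOrder
    order-exists B′? {suc m} _ B′mg with least-witness (B′? ∘ suc) {m} B′mg
    ... | k , B′kg , least = suc k , record
      { positive = s≤s z≤n ; annihilates = B′kg ; minimal = λ { {suc j} _ B′jg → s≤s (least B′jg) } }

    module _ {o} (order : IsOrder o) where
      open IsOrder order

      multiple-below-order : ∀ {k} → k < o → B′ (λ i → + k * g i) → k ≡ 0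
      multiple-below-order {zero}  _   _     = refl
      multiple-below-order {suc k} k<o B′kg = ⊥-elim (ℕP.<⇒≱ k<o (minimal (s≤s z≤n) B′kg))

      difference-below-order : ∀ {a b} → a < o → b ≤ a → B′ (λ i → (+ a - + b) * g i) → a ≡ b
      difference-below-order {a} {b} a<o b≤a B′ = ℕP.≤-antisym
        (ℕP.m∸n≡0⇒m≤n (multiple-below-order (ℕP.≤-<-trans (ℕP.m∸n≤m a b) a<o)
          (≗-closed (λ i → cong (_* g i) (trans (ℤP.m-n≡m⊖n a b) (ℤP.⊖-≥ b≤a))) B′)))
        b≤a

      cyclicFibres : ∀ {S : (Fin n → ℤ) → Set} → (∀ {z} c → S z → S (λ i → z i + c * g i)) →
        Quotients.CyclicFibres {S = S} ≋′-isEquivalence ≋-isEquivalence B′⊆B o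
      cyclicFibres S-shift = record
        { shift           = λ z k i → z i + + toℕ k * g i
        ; shift-∈         = λ k → S-shift (+ toℕ k)
        ; shift-∼         = λ z k → IsSubmodule.≗-closed B-sub (λ i → added (z i) (+ toℕ k) (g i))
                                      (IsSubmodule.scale-closed B-sub (+ toℕ k) g∈B)
        ; ∼-shift         = λ {z} {z′} z≋z′ → let k , B′ = reduce-modulo {{ℕ.>-nonZero positive}} annihilates z≋z′
                              in k , ≗-closed (λ i → regroup (z i) (z′ i) (+ toℕ k) (g i)) B′
        ; shift-injective = shift-injective
        }
        where
        added : ∀ a k x → k * x ≡ a + k * x - a
        added = solve-∀
        regroup : ∀ a b k x → a - b - k * x ≡ a - (b + k * x)
        regroup = solve-∀
        difference : ∀ z a b x → z + a * x - (z + b * x) ≡ (a - b) * x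
        difference = solve-∀
        negate : ∀ a b x → -1ℤ * ((a - b) * x) ≡ (b - a) * x
        negate = solve-∀
        ≡-from-difference : ∀ {k k′ : Fin o} → B′ (λ i → (+ toℕ k - + toℕ k′) * g i) → k ≡ k′
        ≡-from-difference {k} {k′} B′k-k′ with ℕP.≤-total (toℕ k′) (toℕ k)
        ... | inj₁ k′≤k = FinP.toℕ-injective (difference-below-order (FinP.toℕ<n k) k′≤k B′k-k′)
        ... | inj₂ k≤k′ = sym (FinP.toℕ-injective (difference-below-order (FinP.toℕ<n k′) k≤k′
            (≗-closed (λ i → negate (+ toℕ k) (+ toℕ k′) (g i)) (scale-closed -1ℤ B′k-k′))))
        shift-injective : ∀ z {k k′} → (λ i → z i + + toℕ k * g i) ≋′ (λ i → z i + + toℕ k′ * g i) → k ≡ k′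
        shift-injective z {k} {k′} shifts≋ =
          ≡-from-difference (≗-closed (λ i → difference (z i) (+ toℕ k) (+ toℕ k′) (g i)) shifts≋)

  unit : ∀ {m} → Fin m → Fin m → ℤ
  unit zero    zero    = 1ℤ
  unit zero    (suc j) = 0ℤ
  unit (suc σ) zero    = 0ℤ
  unit (suc σ) (suc j) = unit σ j

  unit-diagonal : ∀ {m} (σ : Fin m) → unit σ σ ≡ 1ℤ
  unit-diagonal zero    = refl
  unit-diagonal (suc σ) = unit-diagonal σ

  unit-off-diagonal : ∀ {m} {σ j : Fin m} → j ≢ σ → unit σ j ≡ 0ℤ
  unit-off-diagonal {σ = zero}  {zero}  j≢σ = ⊥-elim (j≢σ refl)
  unit-off-diagonal {σ = zero}  {suc j} j≢σ = refl
  unit-off-diagonal {σ = suc σ} {zero}  j≢σ = refl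
  unit-off-diagonal {σ = suc σ} {suc j} j≢σ = unit-off-diagonal (j≢σ ∘ cong suc)

  sumℤ-unit : ∀ {m} (σ : Fin m) (f : Fin m → ℤ) → sumℤ m (λ j → unit σ j * f j) ≡ f σ
  sumℤ-unit {suc m} zero f = trans
    (cong₂ _+_ (ℤP.*-identityˡ (f zero)) (sumℤ-zero m (λ j → ℤP.*-zeroˡ (f (suc j)))))
    (ℤP.+-identityʳ (f zero))
  sumℤ-unit {suc m} (suc σ) f = trans
    (cong₂ _+_ (ℤP.*-zeroˡ (f zero)) (sumℤ-unit σ (f ∘ suc)))
    (ℤP.+-identityˡ (f (suc σ)))

  module Matrix {m n} (M : Fin m → Fin n → ℤ) where

    combination : (Fin m → ℤ) → Fin n → ℤ
    combination a i = sumℤ m (λ j → a j * M j i)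

    combination-lincomb : ∀ p q a b i →
      combination (λ j → p * a j + q * b j) i ≡ p * combination a i + q * combination b i
    combination-lincomb p q a b i = trans
      (sumℤ-cong m (λ j → distrib p q (a j) (b j) (M j i)))
      (sumℤ-lincomb m p q (λ j → a j * M j i) (λ j → b j * M j i))
      where
      distrib : ∀ p q a b x → (p * a + q * b) * x ≡ p * (a * x) + q * (b * x)
      distrib = solve-∀

    combination-zero : ∀ i → combination (λ _ → 0ℤ) i ≡ 0ℤ
    combination-zero i = sumℤ-zero m (λ j → ℤP.*-zeroˡ (M j i))

    combination-unit : ∀ σ i → combination (unit σ) i ≡ M σ i
    combination-unit σ i = sumℤ-unit σ (λ j → M j i)

    IsLeftNull : (Fin m → ℤ) → Set
    IsLeftNull a = ∀ i → combination a i ≡ 0ℤ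

    leftNull-isSubmodule : IsSubmodule IsLeftNull
    leftNull-isSubmodule = record
      { ≗-closed       = λ a≗b a∈ i → trans (sumℤ-cong m (λ j → cong (_* M j i) (sym (a≗b j)))) (a∈ i)
      ; 0-closed       = combination-zero
      ; lincomb-closed = λ {a} {b} p q a∈ b∈ i → trans (combination-lincomb p q a b i)
          (trans (cong₂ (λ x y → p * x + q * y) (a∈ i) (b∈ i)) (vanish p q))
      }
      where
      vanish : ∀ p q → p * 0ℤ + q * 0ℤ ≡ 0ℤ
      vanish = solve-∀

    InImageAvoiding : (Fin m → Set) → (Fin n → ℤ) → Set
    InImageAvoiding F z = Σ (Fin m → ℤ) λ a → (∀ j → F j → a j ≡ 0ℤ) × (∀ i → z i ≡ combination a i)

    image-isSubmodule : ∀ F → IsSubmodule (InImageAvoiding F)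
    image-isSubmodule F = record
      { ≗-closed       = λ { u≗v (a , a∈ , u≡) → a , a∈ , λ i → trans (sym (u≗v i)) (u≡ i) }
      ; 0-closed       = (λ _ → 0ℤ) , (λ _ _ → refl) , λ i → sym (combination-zero i)
      ; lincomb-closed = λ { p q (a , a∈ , u≡) (b , b∈ , v≡) →
          (λ j → p * a j + q * b j) ,
          (λ j Fj → trans (cong₂ (λ x y → p * x + q * y) (a∈ j Fj) (b∈ j Fj)) (vanish p q)) ,
          (λ i → trans (cong₂ (λ x y → p * x + q * y) (u≡ i) (v≡ i)) (sym (combination-lincomb p q a b i))) }
      }
      where
      vanish : ∀ p q → p * 0ℤ + q * 0ℤ ≡ 0ℤ
      vanish = solve-∀

    image-antitone : ∀ {F F′ : Fin m → Set} {z} → (∀ j → F′ j → F j) → InImageAvoiding F z → InImageAvoiding F′ z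
    image-antitone F′⊆F (a , a∈ , z≡) = a , (λ j → a∈ j ∘ F′⊆F j) , z≡

    row-∈-image : ∀ {F : Fin m → Set} {σ} → ¬ F σ → InImageAvoiding F (M σ)
    row-∈-image {σ = σ} ¬Fσ = unit σ ,
      (λ j Fj → unit-off-diagonal {σ = σ} {j} λ { refl → ¬Fσ Fj }) , λ i → sym (combination-unit σ i)

    remove-row : ∀ {F : Fin m → Set} σ a → (∀ j → F j → a j ≡ 0ℤ) →
      InImageAvoiding (λ j → F j ⊎ j ≡ σ) (λ i → combination a i - a σ * M σ i)
    remove-row {F} σ a a∈ = (λ j → 1ℤ * a j + - a σ * unit σ j) , vanishing ,
      λ i → sym (trans (combination-lincomb 1ℤ (- a σ) a (unit σ) i)
        (trans (cong (λ x → 1ℤ * combination a i + - a σ * x) (combination-unit σ i)) (identity (combination a i) (a σ) (M σ i))))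
      where
      identity : ∀ x c y → 1ℤ * x + - c * y ≡ x - c * y
      identity = solve-∀
      cancel : ∀ x → 1ℤ * x + - x * 1ℤ ≡ 0ℤ
      cancel = solve-∀
      drop : ∀ x c → 1ℤ * x + - c * 0ℤ ≡ x
      drop = solve-∀
      vanishing : ∀ j → F j ⊎ j ≡ σ → 1ℤ * a j + - a σ * unit σ j ≡ 0ℤ
      vanishing j (inj₂ refl) = trans (cong (λ x → 1ℤ * a j + - a j * x) (unit-diagonal j)) (cancel (a j))
      vanishing j (inj₁ Fj) with j FinP.≟ σ
      ... | yes refl = trans (cong (λ x → 1ℤ * a j + - a j * x) (unit-diagonal j)) (cancel (a j))
      ... | no  j≢σ  = trans (cong (λ x → 1ℤ * a j + - a σ * x) (unit-off-diagonal j≢σ)) (trans (drop (a j) (a σ)) (a∈ j Fj))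

    leftNull-coefficient-∈-image : ∀ {F : Fin m → Set} σ b → IsLeftNull b → (∀ j → F j → b j ≡ 0ℤ) →
      InImageAvoiding (λ j → F j ⊎ j ≡ σ) (λ i → b σ * M σ i)
    leftNull-coefficient-∈-image {F} σ b b-null b∈ = IsSubmodule.≗-closed (image-isSubmodule _)
      (λ i → trans (cong (λ x → -1ℤ * (x - b σ * M σ i)) (b-null i)) (identity (b σ) (M σ i)))
      (IsSubmodule.scale-closed (image-isSubmodule _) -1ℤ (remove-row {F} σ b b∈))
      where
      identity : ∀ c y → -1ℤ * (0ℤ - c * y) ≡ c * y
      identity = solve-∀

    image-coefficient-leftNull : ∀ {F : Fin m → Set} σ k → ¬ F σ →
      InImageAvoiding (λ j → F j ⊎ j ≡ σ) (λ i → k * M σ i) →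
      ∃ λ b → IsLeftNull b × (∀ j → F j → b j ≡ 0ℤ) × b σ ≡ k
    image-coefficient-leftNull σ k ¬Fσ (a , a∈ , ka≡) = (λ j → k * unit σ j + -1ℤ * a j) ,
      (λ i → trans (combination-lincomb k -1ℤ (unit σ) a i)
        (trans (cong₂ (λ x y → k * x + -1ℤ * y) (combination-unit σ i) (sym (ka≡ i))) (cancel k (M σ i)))) ,
      (λ j Fj → trans (cong₂ (λ x y → k * x + -1ℤ * y)
        (unit-off-diagonal {σ = σ} {j} λ { refl → ¬Fσ Fj }) (a∈ j (inj₁ Fj))) (vanish k)) ,
      trans (cong₂ (λ x y → k * x + -1ℤ * y) (unit-diagonal σ) (a∈ σ (inj₂ refl))) (keep k)
      where
      cancel : ∀ k y → k * y + -1ℤ * (k * y) ≡ 0ℤ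
      cancel = solve-∀
      vanish : ∀ k → k * 0ℤ + -1ℤ * 0ℤ ≡ 0ℤ
      vanish = solve-∀
      keep : ∀ k → k * 1ℤ + -1ℤ * 0ℤ ≡ k
      keep = solve-∀

module RationalArithmetic where
  open import Data.Integer using (_*_)
  open ℚᵘP using (≃-trans; ≃-sym)

  sumℚ-cong : ∀ n {f g : Fin n → ℚ} → f ≗ g → sumℚ n f ≡ sumℚ n g
  sumℚ-cong zero    f≗g = refl
  sumℚ-cong (suc n) f≗g = cong₂ ℚ._+_ (f≗g zero) (sumℚ-cong n (f≗g ∘ suc))

  sumℚ-lincomb : ∀ n (p q : ℚ) (f g : Fin n → ℚ) →
    sumℚ n (λ j → p ℚ.* f j ℚ.+ q ℚ.* g j) ≡ p ℚ.* sumℚ n f ℚ.+ q ℚ.* sumℚ n g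
  sumℚ-lincomb zero    p q f g = sym (cong₂ ℚ._+_ (ℚP.*-zeroʳ p) (ℚP.*-zeroʳ q))
  sumℚ-lincomb (suc n) p q f g = trans
    (cong ((p ℚ.* f zero ℚ.+ q ℚ.* g zero) ℚ.+_) (sumℚ-lincomb n p q (f ∘ suc) (g ∘ suc)))
    (rearrange p q (f zero) (g zero) (sumℚ n (f ∘ suc)) (sumℚ n (g ∘ suc)))
    where
    open +-*-Solver
    rearrange : ∀ p q a b x y →
      p ℚ.* a ℚ.+ q ℚ.* b ℚ.+ (p ℚ.* x ℚ.+ q ℚ.* y) ≡ p ℚ.* (a ℚ.+ x) ℚ.+ q ℚ.* (b ℚ.+ y)
    rearrange = solve 6 (λ p q a b x y →
      p :* a :+ q :* b :+ (p :* x :+ q :* y) := p :* (a :+ x) :+ q :* (b :+ y)) refl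


  toℚᵘ-toℚ : ∀ z → ℚ.toℚᵘ (toℚ z) ℚᵘ.≃ ℚᵘ.mkℚᵘ z 0
  toℚᵘ-toℚ z = ℚP.toℚᵘ-fromℚᵘ (ℚᵘ.mkℚᵘ z 0)

  toℚ-injective : ∀ {a b} → toℚ a ≡ toℚ b → a ≡ b
  toℚ-injective {a} {b} eq with ℚP.fromℚᵘ-injective {ℚᵘ.mkℚᵘ a 0} {ℚᵘ.mkℚᵘ b 0} eq
  ... | ℚᵘ.*≡* a*1≡b*1 = trans (sym (ℤP.*-identityʳ a)) (trans a*1≡b*1 (ℤP.*-identityʳ b))

  toℚ-via-ℚᵘ : ∀ z {p} → ℚᵘ.mkℚᵘ z 0 ℚᵘ.≃ ℚ.toℚᵘ p → toℚ z ≡ p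
  toℚ-via-ℚᵘ z {p} e = ℚP.toℚᵘ-injective {toℚ z} {p} (≃-trans (toℚᵘ-toℚ z) e)

  toℚ-+ : ∀ a b → toℚ (a + b) ≡ toℚ a ℚ.+ toℚ b
  toℚ-+ a b = toℚ-via-ℚᵘ (a + b) (≃-trans (ℚᵘ.*≡* (identity a b))
    (≃-trans (ℚᵘP.+-cong (≃-sym (toℚᵘ-toℚ a)) (≃-sym (toℚᵘ-toℚ b)))
             (≃-sym (ℚP.toℚᵘ-homo-+ (toℚ a) (toℚ b)))))
    where
    identity : ∀ a b → (a + b) * (1ℤ * 1ℤ) ≡ (a * 1ℤ + b * 1ℤ) * 1ℤ
    identity = solve-∀

  toℚ-* : ∀ a b → toℚ (a * b) ≡ toℚ a ℚ.* toℚ b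
  toℚ-* a b = toℚ-via-ℚᵘ (a * b) (≃-trans (ℚᵘ.*≡* (identity a b))
    (≃-trans (ℚᵘP.*-cong (≃-sym (toℚᵘ-toℚ a)) (≃-sym (toℚᵘ-toℚ b)))
             (≃-sym (ℚP.toℚᵘ-homo-* (toℚ a) (toℚ b)))))
    where
    identity : ∀ a b → (a * b) * (1ℤ * 1ℤ) ≡ (a * b) * 1ℤ
    identity = solve-∀

  ↧-*-cancel : ∀ w → toℚ (+ ↧ₙ w) ℚ.* w ≡ toℚ (↥ w)
  ↧-*-cancel w@(ℚ.mkℚ n dm _) = sym (toℚ-via-ℚᵘ n (≃-trans
    (ℚᵘ.*≡* (trans (cong (λ k → n * + k) (ℕP.*-identityˡ (suc dm))) (identity n (+ suc dm))))
    (≃-trans (ℚᵘP.*-cong (≃-sym (toℚᵘ-toℚ (+ suc dm))) ℚᵘP.≃-refl)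
             (≃-sym (ℚP.toℚᵘ-homo-* (toℚ (+ suc dm)) w)))))
    where
    identity : ∀ n d → n * d ≡ (d * n) * 1ℤ
    identity = solve-∀

  toℚ-sumℤ : ∀ n (f : Fin n → ℤ) → toℚ (sumℤ n f) ≡ sumℚ n (toℚ ∘ f)
  toℚ-sumℤ zero    f = refl
  toℚ-sumℤ (suc n) f = trans (toℚ-+ (f zero) (sumℤ n (f ∘ suc))) (cong (ℚ._+_ (toℚ (f zero))) (toℚ-sumℤ n (f ∘ suc)))

  toℚ-ℕ-* : ∀ m n → toℚ (+ (m ℕ.* n)) ≡ toℚ (+ m) ℚ.* toℚ (+ n)
  toℚ-ℕ-* m n = trans (cong toℚ (ℤP.pos-* m n)) (toℚ-* (+ m) (+ n))

  ↧ₙ-nonZero : ∀ w → ℕ.NonZero (↧ₙ w)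
  ↧ₙ-nonZero (ℚ.mkℚ _ _ _) = _

  common-denominator : ∀ n (w : Fin n → ℚ) →
    Σ ℕ λ D → ℕ.NonZero D × Σ (Fin n → ℤ) λ x → ∀ j → toℚ (x j) ≡ toℚ (+ D) ℚ.* w j
  common-denominator zero    w = 1 , _ , (λ ()) , λ ()
  common-denominator (suc n) w with common-denominator n (w ∘ suc)
  ... | D , D≢0 , x , x≡Dw = d ℕ.* D , ℕP.m*n≢0 d D {{↧ₙ-nonZero (w zero)}} {{D≢0}} , x′ , x′≡dDw
    where
    open ≡-Reasoning
    d = ↧ₙ (w zero)
    x′ : Fin (suc n) → ℤ
    x′ zero    = ↥ w zero * + D
    x′ (suc j) = + d * x j
    x′≡dDw : ∀ j → toℚ (x′ j) ≡ toℚ (+ (d ℕ.* D)) ℚ.* w j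
    x′≡dDw zero = begin
      toℚ (↥ w zero * + D)                          ≡⟨ toℚ-* (↥ w zero) (+ D) ⟩
      toℚ (↥ w zero) ℚ.* toℚ (+ D)                  ≡⟨ cong (ℚ._* toℚ (+ D)) (↧-*-cancel (w zero)) ⟨
      toℚ (+ d) ℚ.* w zero ℚ.* toℚ (+ D)            ≡⟨ ℚP.*-assoc (toℚ (+ d)) (w zero) (toℚ (+ D)) ⟩
      toℚ (+ d) ℚ.* (w zero ℚ.* toℚ (+ D))          ≡⟨ cong (toℚ (+ d) ℚ.*_) (ℚP.*-comm (w zero) (toℚ (+ D))) ⟩
      toℚ (+ d) ℚ.* (toℚ (+ D) ℚ.* w zero)          ≡⟨ ℚP.*-assoc (toℚ (+ d)) (toℚ (+ D)) (w zero) ⟨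
      toℚ (+ d) ℚ.* toℚ (+ D) ℚ.* w zero            ≡⟨ cong (ℚ._* w zero) (toℚ-ℕ-* d D) ⟨
      toℚ (+ (d ℕ.* D)) ℚ.* w zero                  ∎
    x′≡dDw (suc j) = begin
      toℚ (+ d * x j)                               ≡⟨ toℚ-* (+ d) (x j) ⟩
      toℚ (+ d) ℚ.* toℚ (x j)                       ≡⟨ cong (toℚ (+ d) ℚ.*_) (x≡Dw j) ⟩
      toℚ (+ d) ℚ.* (toℚ (+ D) ℚ.* w (suc j))       ≡⟨ ℚP.*-assoc (toℚ (+ d)) (toℚ (+ D)) (w (suc j)) ⟨
      toℚ (+ d) ℚ.* toℚ (+ D) ℚ.* w (suc j)         ≡⟨ cong (ℚ._* w (suc j)) (toℚ-ℕ-* d D) ⟨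
      toℚ (+ (d ℕ.* D)) ℚ.* w (suc j)               ∎

  *-solveˡ : ∀ {a x b : ℚ} (a≢0 : a ≢ 0ℚ) → a ℚ.* x ≡ b → x ≡ (ℚ.1/ a) {{ℚ.≢-nonZero a≢0}} ℚ.* b
  *-solveˡ {a} {x} {b} a≢0 ax≡b = begin
    x                        ≡⟨ ℚP.*-identityˡ x ⟨
    ℚ.1ℚ ℚ.* x               ≡⟨ cong (ℚ._* x) (ℚP.*-inverseˡ a) ⟨
    a⁻¹ ℚ.* a ℚ.* x          ≡⟨ ℚP.*-assoc a⁻¹ a x ⟩
    a⁻¹ ℚ.* (a ℚ.* x)        ≡⟨ cong (a⁻¹ ℚ.*_) ax≡b ⟩
    a⁻¹ ℚ.* b                ∎
    where
    open ≡-Reasoning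
    instance _ = ℚ.≢-nonZero a≢0
    a⁻¹ = ℚ.1/ a

module CellularChains where
  open import Data.Integer using (_*_)
  open IntegerLinearAlgebra
  open RationalArithmetic

  module Flows {d} (Σc : CWComplex d) where
    open Matrix (∂d Σc)

    IsFlowℚ-≗ : ∀ {v w} → v ≗ w → IsFlowℚ Σc v → IsFlowℚ Σc w
    IsFlowℚ-≗ v≗w v-flow i = trans (sumℚ-cong (nFacets Σc) (λ j → cong (ℚ._* _) (sym (v≗w j)))) (v-flow i)

    IsFlowℚ-lincomb : ∀ p q {v w} → IsFlowℚ Σc v → IsFlowℚ Σc w → IsFlowℚ Σc (λ j → p ℚ.* v j ℚ.+ q ℚ.* w j)
    IsFlowℚ-lincomb p q {v} {w} v-flow w-flow i = begin
      sumℚ (nFacets Σc) (λ j → (p ℚ.* v j ℚ.+ q ℚ.* w j) ℚ.* toℚ (∂d Σc j i))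
        ≡⟨ sumℚ-cong (nFacets Σc) (λ j → distrib p q (v j) (w j) (toℚ (∂d Σc j i))) ⟩
      sumℚ (nFacets Σc) (λ j → p ℚ.* (v j ℚ.* toℚ (∂d Σc j i)) ℚ.+ q ℚ.* (w j ℚ.* toℚ (∂d Σc j i)))
        ≡⟨ sumℚ-lincomb (nFacets Σc) p q _ _ ⟩
      p ℚ.* sumℚ (nFacets Σc) (λ j → v j ℚ.* toℚ (∂d Σc j i)) ℚ.+
      q ℚ.* sumℚ (nFacets Σc) (λ j → w j ℚ.* toℚ (∂d Σc j i))
        ≡⟨ cong₂ (λ x y → p ℚ.* x ℚ.+ q ℚ.* y) (v-flow i) (w-flow i) ⟩
      p ℚ.* 0ℚ ℚ.+ q ℚ.* 0ℚ
        ≡⟨ cong₂ ℚ._+_ (ℚP.*-zeroʳ p) (ℚP.*-zeroʳ q) ⟩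
      0ℚ ∎
      where
      open ≡-Reasoning
      open +-*-Solver
      distrib : ∀ p q a b x → (p ℚ.* a ℚ.+ q ℚ.* b) ℚ.* x ≡ p ℚ.* (a ℚ.* x) ℚ.+ q ℚ.* (b ℚ.* x)
      distrib = solve 5 (λ p q a b x → (p :* a :+ q :* b) :* x := p :* (a :* x) :+ q :* (b :* x)) refl

    IsFlowℚ-scale : ∀ p {w} → IsFlowℚ Σc w → IsFlowℚ Σc (λ j → p ℚ.* w j)
    IsFlowℚ-scale p {w} w-flow = IsFlowℚ-≗ {λ j → p ℚ.* w j ℚ.+ 0ℚ ℚ.* w j} {λ j → p ℚ.* w j}
      (λ j → trans (cong (p ℚ.* w j ℚ.+_) (ℚP.*-zeroˡ (w j))) (ℚP.+-identityʳ _))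
      (IsFlowℚ-lincomb p 0ℚ {w} {w} w-flow w-flow)

    toℚ-combination : ∀ a i → toℚ (combination a i) ≡ sumℚ (nFacets Σc) (λ j → toℚ (a j) ℚ.* toℚ (∂d Σc j i))
    toℚ-combination a i = trans (toℚ-sumℤ (nFacets Σc) _) (sumℚ-cong (nFacets Σc) (λ j → toℚ-* (a j) (∂d Σc j i)))

    toℚ-flow : ∀ {a} → IsLeftNull a → IsFlowℚ Σc (toℚ ∘ a)
    toℚ-flow {a} a-null i = trans (sym (toℚ-combination a i)) (cong toℚ (a-null i))

    leftNull-from-flow : ∀ {a} → IsFlowℚ Σc (toℚ ∘ a) → IsLeftNull a
    leftNull-from-flow {a} a-flow i = toℚ-injective (trans (toℚ-combination a i) (a-flow i))

  module Circuit {d} (Σc : CWComplex d) (C : Subset (nFacets Σc)) (circuit : IsCircuit Σc C) where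
    open Matrix (∂d Σc)
    open Flows Σc

    flow-vanishes : ∀ {w} → IsFlowℚ Σc w → SupportedOn Σc w C → ∀ {σ} → σ ∈ C → w σ ≡ 0ℚ → ∀ j → w j ≡ 0ℚ
    flow-vanishes {w} w-flow w⊆C {σ} σ∈C wσ≡0 j with w j ℚP.≟ 0ℚ
    ... | yes wj≡0 = wj≡0
    ... | no  wj≢0 = ⊥-elim (proj₂ circuit (C ∖ σ) (x∈p⇒p-x⊂p σ∈C) (w , w-flow , w⊆C∖σ , j , wj≢0))
      where
      w⊆C∖σ : SupportedOn Σc w (C ∖ σ)
      w⊆C∖σ k k∉C∖σ with k FinP.≟ σ | k ∈? C
      ... | yes refl | _        = wσ≡0
      ... | no  k≢σ  | yes k∈C = ⊥-elim (k∉C∖σ (x∈p∧x≢y⇒x∈p-y k∈C k≢σ))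
      ... | no  _    | no  k∉C = w⊆C k k∉C

    flows-proportional : ∀ {v w} → IsFlowℚ Σc v → SupportedOn Σc v C → IsFlowℚ Σc w → SupportedOn Σc w C →
      ∀ {σ} → σ ∈ C → ∀ j → w σ ℚ.* v j ≡ v σ ℚ.* w j
    flows-proportional {v} {w} v-flow v⊆C w-flow w⊆C {σ} σ∈C j = difference-zero (w σ ℚ.* v j) (v σ ℚ.* w j)
      (trans (rearrange (w σ) (v σ) (v j) (w j)) (flow-vanishes u-flow u⊆C σ∈C (cancel (w σ) (v σ)) j))
      where
      open +-*-Solver
      u : Fin (nFacets Σc) → ℚ
      u k = w σ ℚ.* v k ℚ.+ ℚ.- v σ ℚ.* w k
      u-flow : IsFlowℚ Σc u
      u-flow = IsFlowℚ-lincomb (w σ) (ℚ.- v σ) {v} {w} v-flow w-flow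
      u⊆C : SupportedOn Σc u C
      u⊆C k k∉C = trans (cong₂ (λ x y → w σ ℚ.* x ℚ.+ ℚ.- v σ ℚ.* y) (v⊆C k k∉C) (w⊆C k k∉C))
        (vanish (w σ) (v σ))
        where
        vanish : ∀ p q → p ℚ.* 0ℚ ℚ.+ ℚ.- q ℚ.* 0ℚ ≡ 0ℚ
        vanish = solve 2 (λ p q → p :* con 0ℚ :+ :- q :* con 0ℚ := con 0ℚ) refl
      cancel : ∀ a b → a ℚ.* b ℚ.+ ℚ.- b ℚ.* a ≡ 0ℚ
      cancel = solve 2 (λ a b → a :* b :+ :- b :* a := con 0ℚ) refl
      rearrange : ∀ a b x y → a ℚ.* x ℚ.- b ℚ.* y ≡ a ℚ.* x ℚ.+ ℚ.- b ℚ.* y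
      rearrange = solve 4 (λ a b x y → a :* x :- b :* y := a :* x :+ :- b :* y) refl
      difference-zero : ∀ a b → a ℚ.- b ≡ 0ℚ → a ≡ b
      difference-zero a b a-b≡0 = trans (shift a b) (trans (cong (ℚ._+ b) a-b≡0) (ℚP.+-identityˡ b))
        where
        shift : ∀ a b → a ≡ a ℚ.- b ℚ.+ b
        shift = solve 2 (λ a b → a := a :- b :+ b) refl

    IsIntegralFlow : (Fin (nFacets Σc) → ℤ) → Set
    IsIntegralFlow b = IsLeftNull b × (∀ j → j ∉ C → b j ≡ 0ℤ)

    toℚ-support : ∀ {b} → IsIntegralFlow b → SupportedOn Σc (toℚ ∘ b) C
    toℚ-support (_ , b⊆C) j j∉C = cong toℚ (b⊆C j j∉C)

    integral-flows-proportional : ∀ {a b} → IsIntegralFlow a → IsIntegralFlow b →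
      ∀ {σ} → σ ∈ C → ∀ j → b σ * a j ≡ a σ * b j
    integral-flows-proportional {a} {b} a-flow b-flow {σ} σ∈C j = toℚ-injective (begin
      toℚ (b σ * a j)              ≡⟨ toℚ-* (b σ) (a j) ⟩
      toℚ (b σ) ℚ.* toℚ (a j)      ≡⟨ flows-proportional (toℚ-flow {a} (proj₁ a-flow)) (toℚ-support a-flow)
                                        (toℚ-flow {b} (proj₁ b-flow)) (toℚ-support b-flow) σ∈C j ⟩
      toℚ (a σ) ℚ.* toℚ (b j)      ≡⟨ toℚ-* (a σ) (b j) ⟨
      toℚ (a σ * b j)              ∎)
      where open ≡-Reasoning

    integral-flow-nonzero : ∀ {b} → IsIntegralFlow b → ∀ {ρ σ} → ρ ∈ C → b ρ ≢ 0ℤ → σ ∈ C → b σ ≢ 0ℤ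
    integral-flow-nonzero {b} b-flow {ρ} ρ∈C bρ≢0 σ∈C bσ≡0 = bρ≢0 (toℚ-injective
      (flow-vanishes (toℚ-flow {b} (proj₁ b-flow)) (toℚ-support b-flow) σ∈C (cong toℚ bσ≡0) ρ))

    integral-flow-spans : ∀ {v} → IsIntegralFlow v → ∀ {ρ} → ρ ∈ C → v ρ ≢ 0ℤ →
      ∀ w → IsFlowℚ Σc w → SupportedOn Σc w C → ∃ λ c → ∀ j → w j ≡ c ℚ.* toℚ (v j)
    integral-flow-spans {v} v-flow {ρ} ρ∈C vρ≢0 w w-flow w⊆C = vρ⁻¹ ℚ.* w ρ , λ j → trans
      (*-solveˡ vρ≢0ℚ (flows-proportional w-flow w⊆C (toℚ-flow {v} (proj₁ v-flow)) (toℚ-support v-flow) ρ∈C j))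
      (sym (ℚP.*-assoc vρ⁻¹ (w ρ) (toℚ (v j))))
      where
      vρ≢0ℚ : toℚ (v ρ) ≢ 0ℚ
      vρ≢0ℚ = vρ≢0 ∘ toℚ-injective
      vρ⁻¹ = (ℚ.1/ toℚ (v ρ)) {{ℚ.≢-nonZero vρ≢0ℚ}}

    -- opaque: only the stated properties of this witness are used, and unfolding it
    -- during unification is very expensive
    opaque
      nonzero-integral-flow : ∃ λ x → IsIntegralFlow x × ∃ λ ρ → ρ ∈ C × ∀ {σ} → σ ∈ C → x σ ≢ 0ℤ
      nonzero-integral-flow with proj₁ circuit
      ... | w , w-flow , w⊆C , ρ , wρ≢0 with common-denominator (nFacets Σc) w
      ...   | D , D≢0 , x , x≡Dw = x , x-flow , ρ , ρ∈C , integral-flow-nonzero x-flow ρ∈C xρ≢0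
        where
        ρ∈C : ρ ∈ C
        ρ∈C with ρ ∈? C
        ... | yes ρ∈C = ρ∈C
        ... | no  ρ∉C = ⊥-elim (wρ≢0 (w⊆C ρ ρ∉C))
        D≢0ℚ : toℚ (+ D) ≢ 0ℚ
        D≢0ℚ D≡0 = ℕ.≢-nonZero⁻¹ D {{D≢0}} (ℤP.+-injective (toℚ-injective D≡0))
        x-flow : IsIntegralFlow x
        x-flow = leftNull-from-flow {x} (IsFlowℚ-≗ {w = toℚ ∘ x} (sym ∘ x≡Dw) (IsFlowℚ-scale (toℚ (+ D)) {w} w-flow)) ,
          λ j j∉C → toℚ-injective
            (trans (x≡Dw j) (trans (cong (toℚ (+ D) ℚ.*_) (w⊆C j j∉C)) (ℚP.*-zeroʳ (toℚ (+ D)))))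
        xρ≢0 : x ρ ≢ 0ℤ
        xρ≢0 xρ≡0 = wρ≢0 (trans (*-solveˡ D≢0ℚ (trans (sym (x≡Dw ρ)) (cong toℚ xρ≡0)))
          (ℚP.*-zeroʳ ((ℚ.1/ toℚ (+ D)) {{ℚ.≢-nonZero D≢0ℚ}})))

  cycles-isSubmodule : ∀ {d} (Σc : CWComplex d) k → IsSubmodule (IsCycle Σc k)
  cycles-isSubmodule Σc zero    = record { ≗-closed = λ _ _ → tt ; 0-closed = tt ; lincomb-closed = λ _ _ _ _ → tt }
  cycles-isSubmodule Σc (suc k) = Matrix.leftNull-isSubmodule (CWComplex.bd Σc k)

  facet-boundary-isCycle : ∀ {d} (Σc : CWComplex d) σ → IsCycle Σc d (∂d Σc σ)
  facet-boundary-isCycle {zero}  Σc σ   = tt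
  facet-boundary-isCycle {suc d} Σc σ i = CWComplex.bdbd Σc d σ i

  module Homology {d} (Σc : CWComplex d) (C : Subset (nFacets Σc)) (circuit : IsCircuit Σc C) where
    open Matrix (∂d Σc)
    open Circuit Σc C circuit

    -- IsBoundaryOn: boundaries in Δ = Σ_(d-1) ∪ C;  IsBoundaryIn Σc C σ (Defs): boundaries in Δ ∖ σ
    IsBoundaryOn : (Fin (nRidges Σc) → ℤ) → Set
    IsBoundaryOn = InImageAvoiding (_∉ C)

    boundaryOn-isSubmodule : IsSubmodule IsBoundaryOn
    boundaryOn-isSubmodule = image-isSubmodule (_∉ C)

    boundaryIn-isSubmodule : ∀ σ → IsSubmodule (IsBoundaryIn Σc C σ)
    boundaryIn-isSubmodule σ = image-isSubmodule (λ j → j ∉ C ⊎ j ≡ σ)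

    open IsSubmodule boundaryOn-isSubmodule using (Torsion) renaming (_≋_ to HomologousOn)

    boundaryIn⊆boundaryOn : ∀ {σ z} → IsBoundaryIn Σc C σ z → IsBoundaryOn z
    boundaryIn⊆boundaryOn = image-antitone (λ _ → inj₁)

    facet-boundary-∈ : ∀ {σ} → σ ∈ C → IsBoundaryOn (∂d Σc σ)
    facet-boundary-∈ σ∈C = row-∈-image (λ σ∉C → σ∉C σ∈C)

    boundaryOn-split : ∀ {σ u} → IsBoundaryOn u → ∃ λ c → IsBoundaryIn Σc C σ (λ i → u i - c * ∂d Σc σ i)
    boundaryOn-split {σ} (a , a∈ , u≡) = a σ ,
      IsSubmodule.≗-closed (boundaryIn-isSubmodule σ) (λ i → cong (_- a σ * ∂d Σc σ i) (sym (u≡ i))) (remove-row σ a a∈)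

    IsTorsionCycleOn : (Fin (nRidges Σc) → ℤ) → Set
    IsTorsionCycleOn z = IsCycle Σc d z × Torsion z

    torsionCycleOn-shift : ∀ {σ} → σ ∈ C → ∀ {z} c →
      IsTorsionCycleOn z → IsTorsionCycleOn (λ i → z i + c * ∂d Σc σ i)
    torsionCycleOn-shift {σ} σ∈C {z} c (z-cycle , m , m>0 , mz∈) =
      IsSubmodule.≗-closed (cycles-isSubmodule Σc d) (λ i → unit-coefficient (z i) c (∂d Σc σ i))
        (IsSubmodule.lincomb-closed (cycles-isSubmodule Σc d) 1ℤ c z-cycle (facet-boundary-isCycle Σc σ)) ,
      m , m>0 ,
      IsSubmodule.≗-closed boundaryOn-isSubmodule (λ i → distribute (+ m) (z i) c (∂d Σc σ i))
        (IsSubmodule.lincomb-closed boundaryOn-isSubmodule 1ℤ (+ m * c) mz∈ (facet-boundary-∈ σ∈C))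
      where
      unit-coefficient : ∀ a c x → 1ℤ * a + c * x ≡ a + c * x
      unit-coefficient = solve-∀
      distribute : ∀ m a c x → 1ℤ * (m * a) + m * c * x ≡ m * (a + c * x)
      distribute = solve-∀

    torsionOrder-enumeration : ∀ {σ t} → TorsionOrder Σc C σ t → Enumeration (IsTorsionCycle Σc C σ) (Homologous Σc C σ) t
    torsionOrder-enumeration (f , f-torsion , f-injective , f-surjective) = record
      { rep = f ; rep∈S = f-torsion ; rep-injective = f-injective _ _ ; rep-surjective = f-surjective _ }

    module AtFacet {σ} (σ∈C : σ ∈ C) where
      open IsSubmodule (boundaryIn-isSubmodule σ) using (≗-closed; abs-closed)
      open Extension boundaryOn-isSubmodule (boundaryIn-isSubmodule σ) (boundaryIn⊆boundaryOn {σ})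
        (∂d Σc σ) (facet-boundary-∈ σ∈C) boundaryOn-split public
      open Quotients {S = IsTorsionCycleOn} (IsSubmodule.≋-isEquivalence (boundaryIn-isSubmodule σ))
        (IsSubmodule.≋-isEquivalence boundaryOn-isSubmodule) (boundaryIn⊆boundaryOn {σ}) public

      flow-coefficient-∈ : ∀ {b} → IsIntegralFlow b → IsBoundaryIn Σc C σ (λ i → + ∣ b σ ∣ * ∂d Σc σ i)
      flow-coefficient-∈ {b} (b-null , b⊆C) = abs-closed (b σ) (leftNull-coefficient-∈-image σ b b-null b⊆C)

      flow-with-coefficient : ∀ {k} → IsBoundaryIn Σc C σ (λ i → k * ∂d Σc σ i) → ∃ λ b → IsIntegralFlow b × b σ ≡ k
      flow-with-coefficient {k} kg∈ with image-coefficient-leftNull σ k (λ σ∉C → σ∉C σ∈C) kg∈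
      ... | b , b-null , b⊆C , bσ≡k = b , (b-null , b⊆C) , bσ≡k

      annihilating-multiple : ∃ λ m → 0 < m × IsBoundaryIn Σc C σ (λ i → + m * ∂d Σc σ i)
      annihilating-multiple = multiple-of nonzero-integral-flow
        where
        multiple-of : (∃ λ x → IsIntegralFlow x × ∃ λ ρ → ρ ∈ C × ∀ {σ} → σ ∈ C → x σ ≢ 0ℤ) →
          ∃ λ m → 0 < m × IsBoundaryIn Σc C σ (λ i → + m * ∂d Σc σ i)
        multiple-of (x , x-flow , _ , _ , x≢0) =
          ∣ x σ ∣ , ℕP.n≢0⇒n>0 (x≢0 σ∈C ∘ ℤP.∣i∣≡0⇒i≡0) , flow-coefficient-∈ x-flow

      torsionCycle⇔torsionCycleOn : ∀ {z} →
        (IsTorsionCycle Σc C σ z → IsTorsionCycleOn z) × (IsTorsionCycleOn z → IsTorsionCycle Σc C σ z)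
      torsionCycle⇔torsionCycleOn {z} =
        (λ (z-cycle , m , m>0 , mz∈) → z-cycle , m , m>0 , boundaryIn⊆boundaryOn mz∈) ,
        (λ (z-cycle , m , m>0 , mz∈) → z-cycle , m₀ ℕ.* m , ℕP.*-mono-< m₀>0 m>0 ,
           ≗-closed (λ i → trans (sym (ℤP.*-assoc (+ m₀) (+ m) (z i))) (cong (_* z i) (sym (ℤP.pos-* m₀ m))))
             (multiple-∈B′ {m₀} {λ i → + m * z i} m₀g∈ mz∈))
        where
        m₀ = proj₁ annihilating-multiple
        m₀>0 = proj₁ (proj₂ annihilating-multiple)
        m₀g∈ = proj₂ (proj₂ annihilating-multiple)

      multiple-torsionCycleOn : ∀ k → IsTorsionCycleOn (λ i → + k * ∂d Σc σ i)
      multiple-torsionCycleOn k =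
        IsSubmodule.scale-closed (cycles-isSubmodule Σc d) (+ k) (facet-boundary-isCycle Σc σ) ,
        1 , s≤s z≤n ,
        IsSubmodule.≗-closed boundaryOn-isSubmodule (λ i → sym (ℤP.*-identityˡ (+ k * ∂d Σc σ i)))
          (IsSubmodule.scale-closed boundaryOn-isSubmodule (+ k) (facet-boundary-∈ σ∈C))

      zero-torsionCycleOn : IsTorsionCycleOn (λ _ → 0ℤ)
      zero-torsionCycleOn = IsSubmodule.0-closed (cycles-isSubmodule Σc d) , 1 , s≤s z≤n ,
        IsSubmodule.≗-closed boundaryOn-isSubmodule (λ _ → sym (ℤP.*-zeroʳ (+ 1))) (IsSubmodule.0-closed boundaryOn-isSubmodule)

      module _ {t} (torsion : TorsionOrder Σc C σ t) where

        enumeration : Enumeration IsTorsionCycleOn (Homologous Σc C σ) t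
        enumeration = Enumeration-cong (proj₁ torsionCycle⇔torsionCycleOn) (proj₂ torsionCycle⇔torsionCycleOn)
          (torsionOrder-enumeration torsion)

        t≢0 : t ≢ 0
        t≢0 refl = FinP.¬Fin0 (Enumeration.index enumeration zero-torsionCycleOn)

        opaque
          order : ∃ IsOrder
          order = order-exists multiple-decidable {proj₁ annihilating-multiple}
            (proj₁ (proj₂ annihilating-multiple)) (proj₂ (proj₂ annihilating-multiple))
            where
            multiple-decidable : ∀ k → Dec (IsBoundaryIn Σc C σ (λ i → + k * ∂d Σc σ i))
            multiple-decidable k = map′ (≗-closed (λ i → ℤP.+-identityʳ _)) (≗-closed (λ i → sym (ℤP.+-identityʳ _)))
              (≈-decidable enumeration (multiple-torsionCycleOn k) zero-torsionCycleOn)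

        o : ℕ
        o = proj₁ order

        o-positive : 0 < o
        o-positive = IsOrder.positive (proj₂ order)

        fibres : CyclicFibres o
        fibres = cyclicFibres (proj₂ order) (torsionCycleOn-shift σ∈C)

        t≡N*o : ∀ {N} → Enumeration IsTorsionCycleOn HomologousOn N → t ≡ N ℕ.* o
        t≡N*o = count enumeration fibres

        opaque
          torsionOn-enumeration : ∃ λ N → Enumeration IsTorsionCycleOn HomologousOn N
          torsionOn-enumeration = coarsen enumeration (∼-decidable enumeration fibres)

        opaque
          flow-with-order : ∃ λ b → IsIntegralFlow b × b σ ≡ + o
          flow-with-order = flow-with-coefficient (IsOrder.annihilates (proj₂ order))

        order-≤-flow : ∀ {b} → IsIntegralFlow b → b σ ≢ 0ℤ → o ≤ ∣ b σ ∣
        order-≤-flow b-flow bσ≢0 =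
          IsOrder.minimal (proj₂ order) (ℕP.n≢0⇒n>0 (bσ≢0 ∘ ℤP.∣i∣≡0⇒i≡0)) (flow-coefficient-∈ b-flow)

  module _ {d} (Σc : CWComplex d) (C : Subset (nFacets Σc)) (ε : Fin (nFacets Σc) → Sign) (t : Fin (nFacets Σc) → ℕ) where

    signedVector-∈ : ∀ {j} → j ∈ C → signedVector Σc C ε t j ≡ ε j ◃ t j
    signedVector-∈ j∈C rewrite VecP.[]=⇒lookup j∈C = refl

    signedVector-∉ : ∀ {j} → j ∉ C → signedVector Σc C ε t j ≡ 0ℤ
    signedVector-∉ {j} j∉C with Vec.lookup C j in eq
    ... | true  = ⊥-elim (j∉C (VecP.lookup⇒[]= j C eq))
    ... | false = refl

  module Assembly {d} (Σc : CWComplex d) (C : Subset (nFacets Σc)) (circuit : IsCircuit Σc C)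
    (t : Fin (nFacets Σc) → ℕ) (torsion : ∀ σ → σ ∈ C → TorsionOrder Σc C σ (t σ)) where
    open Matrix (∂d Σc)
    open Circuit Σc C circuit
    open Homology Σc C circuit

    order : ∀ {σ} → σ ∈ C → ℕ
    order {σ} σ∈C = AtFacet.o σ∈C (torsion σ σ∈C)

    order-positive : ∀ {σ} (σ∈C : σ ∈ C) → 0 ℕ.< order σ∈C
    order-positive {σ} σ∈C = AtFacet.o-positive σ∈C (torsion σ σ∈C)

    ρ : Fin (nFacets Σc)
    ρ = proj₁ (proj₂ (proj₂ nonzero-integral-flow))

    ρ∈C : ρ ∈ C
    ρ∈C = proj₁ (proj₂ (proj₂ (proj₂ nonzero-integral-flow)))

    N : ℕ
    N = proj₁ (AtFacet.torsionOn-enumeration ρ∈C (torsion ρ ρ∈C))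

    t≡N*order : ∀ {σ} (σ∈C : σ ∈ C) → t σ ≡ N ℕ.* order σ∈C
    t≡N*order {σ} σ∈C =
      AtFacet.t≡N*o σ∈C (torsion σ σ∈C) (proj₂ (AtFacet.torsionOn-enumeration ρ∈C (torsion ρ ρ∈C)))

    x : Fin (nFacets Σc) → ℤ
    x = proj₁ (AtFacet.flow-with-order ρ∈C (torsion ρ ρ∈C))

    x-flow : IsIntegralFlow x
    x-flow = proj₁ (proj₂ (AtFacet.flow-with-order ρ∈C (torsion ρ ρ∈C)))

    xρ≡order : x ρ ≡ + order ρ∈C
    xρ≡order = proj₂ (proj₂ (AtFacet.flow-with-order ρ∈C (torsion ρ ρ∈C)))

    order≢0 : ∀ {σ} (σ∈C : σ ∈ C) → + order σ∈C ≢ 0ℤ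
    order≢0 σ∈C o≡0 = ℕP.<⇒≢ (order-positive σ∈C) (sym (ℤP.+-injective o≡0))

    ∣x∣≡order : ∀ {σ} (σ∈C : σ ∈ C) → ∣ x σ ∣ ≡ order σ∈C
    ∣x∣≡order {σ} σ∈C = *-≤-≡⇒≡ (AtFacet.order-≤-flow σ∈C (torsion σ σ∈C) x-flow xσ≢0)
      (AtFacet.order-≤-flow ρ∈C (torsion ρ ρ∈C) a-flow aρ≢0) ∣xσ∣∣aρ∣≡ (order-positive ρ∈C)
      where
      a : Fin (nFacets Σc) → ℤ
      a = proj₁ (AtFacet.flow-with-order σ∈C (torsion σ σ∈C))
      a-flow : IsIntegralFlow a
      a-flow = proj₁ (proj₂ (AtFacet.flow-with-order σ∈C (torsion σ σ∈C)))
      aσ≡order : a σ ≡ + order σ∈C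
      aσ≡order = proj₂ (proj₂ (AtFacet.flow-with-order σ∈C (torsion σ σ∈C)))
      xσ≢0 : x σ ≢ 0ℤ
      xσ≢0 = integral-flow-nonzero x-flow ρ∈C (order≢0 ρ∈C ∘ trans (sym xρ≡order)) σ∈C
      aρ≢0 : a ρ ≢ 0ℤ
      aρ≢0 = integral-flow-nonzero a-flow σ∈C (order≢0 σ∈C ∘ trans (sym aσ≡order)) ρ∈C
      ∣xσ∣∣aρ∣≡ : ∣ x σ ∣ ℕ.* ∣ a ρ ∣ ≡ order σ∈C ℕ.* order ρ∈C
      ∣xσ∣∣aρ∣≡ = begin
        ∣ x σ ∣ ℕ.* ∣ a ρ ∣             ≡⟨ ℤP.abs-* (x σ) (a ρ) ⟨
        ∣ x σ * a ρ ∣                   ≡⟨ cong ∣_∣ (integral-flows-proportional a-flow x-flow σ∈C ρ) ⟩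
        ∣ a σ * x ρ ∣                   ≡⟨ cong₂ (λ p q → ∣ p * q ∣) aσ≡order xρ≡order ⟩
        ∣ + order σ∈C * + order ρ∈C ∣   ≡⟨ ℤP.abs-* (+ order σ∈C) (+ order ρ∈C) ⟩
        order σ∈C ℕ.* order ρ∈C         ∎
        where open ≡-Reasoning

    ε : Fin (nFacets Σc) → Sign
    ε = sign ∘ x

    signedVector≡N*x : ∀ j → signedVector Σc C ε t j ≡ + N * x j
    signedVector≡N*x j with j ∈? C
    ... | yes j∈C = trans (signedVector-∈ Σc C ε t j∈C)
      (cong (sign (x j) ◃_) (trans (t≡N*order j∈C) (cong (N ℕ.*_) (sym (∣x∣≡order j∈C)))))
    ... | no  j∉C = trans (signedVector-∉ Σc C ε t j∉C)
      (sym (trans (cong (+ N *_) (proj₂ x-flow j j∉C)) (ℤP.*-zeroʳ (+ N))))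

    signedVector-isIntegralFlow : IsIntegralFlow (signedVector Σc C ε t)
    signedVector-isIntegralFlow =
      IsSubmodule.≗-closed leftNull-isSubmodule (sym ∘ signedVector≡N*x)
        (IsSubmodule.scale-closed leftNull-isSubmodule (+ N) (proj₁ x-flow)) ,
      λ j → signedVector-∉ Σc C ε t

    signedVector-nonzero : ∀ j → j ∈ C → signedVector Σc C ε t j ≢ 0ℤ
    signedVector-nonzero j j∈C vj≡0 = AtFacet.t≢0 j∈C (torsion j j∈C) (begin
      t j                           ≡⟨ ℤP.abs-◃ (ε j) (t j) ⟨
      ∣ ε j ◃ t j ∣                 ≡⟨ cong ∣_∣ (signedVector-∈ Σc C ε t j∈C) ⟨
      ∣ signedVector Σc C ε t j ∣   ≡⟨ cong ∣_∣ vj≡0 ⟩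
      0                             ∎)
      where open ≡-Reasoning

open CellularChains
open import Data.Rational using (ℚ; _*_)

theorem5p3 : (d : ℕ) (Σc : CWComplex d) (C : Subset (nFacets Σc)) →
    IsCircuit Σc C →
    (t : Fin (nFacets Σc) → ℕ) →
    ((σ : Fin (nFacets Σc)) → σ ∈ C → TorsionOrder Σc C σ (t σ)) →
    Σ (Fin (nFacets Σc) → Sign) λ ε →
      IsFlowℚ Σc (λ j → toℚ (signedVector Σc C ε t j)) ×
      ((w : Fin (nFacets Σc) → ℚ) → IsFlowℚ Σc w → SupportedOn Σc w C →
        ∃ λ (c : ℚ) → (j : Fin (nFacets Σc)) →
          w j ≡ c * toℚ (signedVector Σc C ε t j)) ×
      ((j : Fin (nFacets Σc)) → j ∈ C → signedVector Σc C ε t j ≢ 0ℤ)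
theorem5p3 d Σc C circuit t torsion =
  ε , toℚ-flow {signedVector Σc C ε t} (proj₁ signedVector-isIntegralFlow) ,
  integral-flow-spans signedVector-isIntegralFlow ρ∈C (signedVector-nonzero ρ ρ∈C) ,
  signedVector-nonzero
  where
  open Flows Σc
  open Circuit Σc C circuit
  open Assembly Σc C circuit t torsion
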